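{- Let $e$ be a planar circular electrical network with $n$ boundary vertices and response matrix $M_R(e)=(x_{ij})$. Let $\Omega^{aux}(e)$ be the $n\times2n$ matrix whose $i$-th row is $(a_i,\ x_{i1},\dots,x_{in})$, where $a_i\in\mathbb{R}^n$ is given by $a_1=e_1-e_n$ and $a_i=e_i-e_{i-1}$ for $2\le i\le n$. Then the row space of $\Omega^{aux}(e)$ is contained in $V'$ and is isotropic for $\lambda_{2n}$, i.e. $\Omega^{aux}(e)\lambda_{2n}\Omega^{aux}(e)^T=0$, for all values of the conductances. Hence this row space is a point of $\mathrm{LG}(n-1,V')$.
   Context: The response matrix $M_R(e)$ of an electrical network (a graph in a disk with $n$ boundary vertices in circular order and positive conductances) maps boundary potentials to boundary currents via Kirchhoff's laws. It is symmetric with zero row sums. $e_1,\dots,e_n$ are the standard basis vectors of $\mathbb{R}^n$. The form is $\lambda_{2n}(u,v)=u\lambda_{2n}v^T$ with $\lambda_{2n}=\begin{pmatrix}0&g\\-g^T&0\end{pmatrix}$, where $g$ is the $n\times n$ lower-triangular matrix of ones (all entries on and below the diagonal equal to $1$). $V'=\{v\in\mathbb{R}^{2n}:\sum_{i\le n}v_i=0,\ \sum_{i>n}v_i=0\}$, a $(2n-2)$-dimensional space on which $\lambda_{2n}$ restricts to a symplectic form. $\mathrm{LG}(n-1,V')$ denotes its Lagrangian Grassmannian. -}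

module Defs where

open import Level using (_⊔_)
open import Algebra.Bundles using (CommutativeRing)
open import Data.Nat using (ℕ; zero; suc)
open import Data.Fin using (Fin; zero; suc; toℕ; fromℕ; inject₁; _↑ˡ_; _↑ʳ_; splitAt; _≟_)
open import Data.Sum using (inj₁; inj₂)
open import Data.List using (List; foldr)
open import Data.Product using (Σ; _×_)
open import Relation.Nullary.Decidable using (⌊_⌋)
open import Data.Bool using (if_then_else_)
import Data.Nat as ℕ

-- Everything is parametrised by the scalar ring R (standing in for ℝ, which
-- is not available in agda-stdlib).
module _ {c ℓ} (R : CommutativeRing c ℓ) where
  open CommutativeRing R using (Carrier; _≈_; _+_; _*_; -_; _-_; 0#; 1#)

  Σᶠ : ∀ {n} → (Fin n → Carrier) → Carrier
  Σᶠ {zero}  f = 0#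
  Σᶠ {suc n} f = f zero + Σᶠ {n} (λ i → f (suc i))

  Matrix : ℕ → ℕ → Set c
  Matrix m k = Fin m → Fin k → Carrier

  δ : ∀ {n} → Fin n → Fin n → Carrier
  δ i j = if ⌊ i ≟ j ⌋ then 1# else 0#

  record Edge (V : ℕ) : Set c where
    field
      src  : Fin V
      tgt  : Fin V
      cond : Carrier

  -- A network with n boundary vertices (the first n vertices, numbered
  -- 1..n in circular order) and `interior` interior vertices.
  record Network (n : ℕ) : Set c where
    field
      interior : ℕ
      edges    : List (Edge (n ℕ.+ interior))
  open Network public

  edgeCurrent : ∀ {V} → (Fin V → Carrier) → Edge V → Fin V → Carrier
  edgeCurrent φ e v =
      (if ⌊ v ≟ Edge.src e ⌋ then Edge.cond e * (φ (Edge.src e) - φ (Edge.tgt e)) else 0#)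
    + (if ⌊ v ≟ Edge.tgt e ⌋ then Edge.cond e * (φ (Edge.tgt e) - φ (Edge.src e)) else 0#)

  netCurrent : ∀ {n} (N : Network n) → (Fin (n ℕ.+ interior N) → Carrier) → Fin (n ℕ.+ interior N) → Carrier
  netCurrent N φ v = foldr (λ e acc → edgeCurrent φ e v + acc) 0# (edges N)

  bdry : ∀ {n} (N : Network n) → Fin n → Fin (n ℕ.+ interior N)
  bdry {n} N i = i ↑ˡ interior N

  intr : ∀ {n} (N : Network n) → Fin (interior N) → Fin (n ℕ.+ interior N)
  intr {n} N k = n ↑ʳ k

  IsResponseMatrix : ∀ {n} → Network n → Matrix n n → Set (c ⊔ ℓ)
  IsResponseMatrix {n} N M =
    (u : Fin n → Carrier) →
    Σ (Fin (n ℕ.+ interior N) → Carrier) λ φ →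
        ((i : Fin n) → φ (bdry N i) ≈ u i)
      × ((k : Fin (interior N)) → netCurrent N φ (intr N k) ≈ 0#)
      × ((i : Fin n) → Σᶠ (λ j → M i j * u j) ≈ netCurrent N φ (bdry N i))

  -- cyclic predecessor: i ↦ i-1, with 1 ↦ n (0-based: zero ↦ n-1)
  prev : ∀ {n} → Fin n → Fin n
  prev {suc n} zero    = fromℕ n
  prev {suc n} (suc j) = inject₁ j

  aVec : ∀ {n} → Fin n → Fin n → Carrier
  aVec i k = δ i k - δ (prev i) k

  Ωaux : ∀ {n} → Matrix n n → Matrix n (n ℕ.+ n)
  Ωaux {n} M i p with splitAt n p
  ... | inj₁ k = aVec i k
  ... | inj₂ j = M i j

  gMat : ∀ {n} → Matrix n n
  gMat i j = if ⌊ toℕ j ℕ.≤? toℕ i ⌋ then 1# else 0#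

  λ2n : ∀ {n} → Matrix (n ℕ.+ n) (n ℕ.+ n)
  λ2n {n} p q with splitAt n p | splitAt n q
  ... | inj₁ i | inj₂ j = gMat i j
  ... | inj₂ i | inj₁ j = - gMat j i
  ... | inj₁ _ | inj₁ _ = 0#
  ... | inj₂ _ | inj₂ _ = 0#

  λform : ∀ {n} → (Fin (n ℕ.+ n) → Carrier) → (Fin (n ℕ.+ n) → Carrier) → Carrier
  λform {n} u v = Σᶠ (λ p → Σᶠ (λ q → u p * λ2n {n} p q * v q))

  InV' : ∀ {n} → (Fin (n ℕ.+ n) → Carrier) → Set ℓ
  InV' {n} v = (Σᶠ (λ i → v (i ↑ˡ n)) ≈ 0#) × (Σᶠ (λ i → v (n ↑ʳ i)) ≈ 0#)

{-# OPTIONS --safe #-}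
-- A response matrix is the Gram matrix of the Dirichlet energy on the harmonic
-- extensions of the boundary basis vectors (discrete Green identity), so it is
-- symmetric, and its row sums vanish because constant potentials carry no
-- energy. Writing A for the matrix with rows a_i, the form splits into blocks as
-- λ(Ω_i, Ω_j) = (A g Mᵀ)_{ij} − (A g Mᵀ)_{ji}, and A g is the identity except for
-- a row of −1's added to its first row, which kills vectors of zero sum. Hence
-- A g Mᵀ = Mᵀ and λ(Ω_i, Ω_j) = M_{ji} − M_{ij} = 0.
module Submission where

open import Defs
open import Algebra.Bundles using (CommutativeRing)
open import Data.Nat using (ℕ)
open import Data.Fin using (Fin)
open import Data.Product using (_×_)

import Data.Nat as ℕ
import Data.Nat.Properties as ℕ
open import Data.Bool using (if_then_else_)
open import Data.Fin using (zero; suc; toℕ; fromℕ; inject₁; punchIn; _↑ˡ_; _↑ʳ_; _≟_; _≤_; _<_)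
open import Data.Fin.Properties
  using ( splitAt-↑ˡ; splitAt-↑ʳ; punchInᵢ≢i; <-cmp; ≤-refl; ≤fromℕ
        ; toℕ-inject₁; ≤̄⇒inject₁<; ℕ<⇒inject₁<)
open import Data.List using (List; []; _∷_; foldr)
open import Data.Product using (_,_; proj₁; proj₂)
open import Function using (_∘_)
open import Level using (Level)
open import Relation.Binary.Definitions using (tri<; tri≈; tri>)
open import Relation.Nullary using (Dec; ¬_)
open import Relation.Nullary.Decidable using (⌊_⌋; isYes≗does; dec-true; dec-false)
import Relation.Binary.PropositionalEquality as ≡
open ≡ using (_≡_; _≢_)

module _ {a b : Level} {A : Set a} {B : Set b} {x y : B} where

  if-⌊⌋-yes : (a? : Dec A) → A → (if ⌊ a? ⌋ then x else y) ≡ x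
  if-⌊⌋-yes a? p = ≡.cong (if_then x else y) (≡.trans (isYes≗does a?) (dec-true a? p))

  if-⌊⌋-no : (a? : Dec A) → ¬ A → (if ⌊ a? ⌋ then x else y) ≡ y
  if-⌊⌋-no a? ¬p = ≡.cong (if_then x else y) (≡.trans (isYes≗does a?) (dec-false a? ¬p))

module _ {c ℓ} (R : CommutativeRing c ℓ) where
  open CommutativeRing R hiding (zero)
  open import Algebra.Properties.Ring ring
    using (-1*x≈-x; -‿distribˡ-*; -‿distribʳ-*; [y-z]x≈yx-zx; -0#≈0#; ⁻¹-anti-homo‿-)
  open import Algebra.Properties.Semiring.Sum semiring
    using ( sum; sum-cong-≋; sum-cong-≗; sum-replicate-zero; sum-remove
          ; ∑-distrib-+; ∑-comm; *-distribˡ-sum; *-distribʳ-sum)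
  open import Relation.Binary.Reasoning.Setoid setoid

  private
    variable
      n : ℕ

  x-0#≈x : ∀ x → x - 0# ≈ x
  x-0#≈x x = trans (+-congˡ -0#≈0#) (+-identityʳ x)

  Σᶠ≡sum : (f : Fin n → Carrier) → Σᶠ R f ≡ sum f
  Σᶠ≡sum {ℕ.zero}  f = ≡.refl
  Σᶠ≡sum {ℕ.suc n} f = ≡.cong (f zero +_) (Σᶠ≡sum (f ∘ suc))

  sum-zero : {f : Fin n → Carrier} → (∀ i → f i ≈ 0#) → sum f ≈ 0#
  sum-zero {n} f≈0 = trans (sum-cong-≋ f≈0) (sum-replicate-zero n)

  sum-neg : (f : Fin n → Carrier) → sum (λ i → - f i) ≈ - sum f
  sum-neg f = begin
    sum (λ i → - f i)      ≈⟨ sum-cong-≋ (λ i → sym (-1*x≈-x (f i))) ⟩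
    sum (λ i → - 1# * f i) ≈⟨ *-distribˡ-sum (- 1#) f ⟨
    - 1# * sum f           ≈⟨ -1*x≈-x (sum f) ⟩
    - sum f                ∎

  sum-minus : (f g : Fin n → Carrier) → sum (λ i → f i - g i) ≈ sum f - sum g
  sum-minus f g = trans (∑-distrib-+ f (λ i → - g i)) (+-congˡ (sum-neg g))

  sum-*-distribˡ-+ : (a f g : Fin n → Carrier) →
                     sum (λ i → a i * (f i + g i)) ≈ sum (λ i → a i * f i) + sum (λ i → a i * g i)
  sum-*-distribˡ-+ a f g =
    trans (sum-cong-≋ (λ i → distribˡ (a i) (f i) (g i))) (∑-distrib-+ (λ i → a i * f i) (λ i → a i * g i))

  sum-↑ : ∀ m n (f : Fin (m ℕ.+ n) → Carrier) → sum f ≈ sum (f ∘ (_↑ˡ n)) + sum (f ∘ (m ↑ʳ_))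
  sum-↑ ℕ.zero    n f = sym (+-identityˡ (sum f))
  sum-↑ (ℕ.suc m) n f = trans (+-congˡ (sum-↑ m n (f ∘ suc))) (sym (+-assoc _ _ _))

  sum-single : (i : Fin n) (f : Fin n → Carrier) → (∀ j → j ≢ i → f j ≈ 0#) → sum f ≈ f i
  sum-single {ℕ.suc n} i f f≈0 = begin
    sum f                               ≈⟨ sum-remove f ⟩
    f i + sum (f ∘ punchIn i)           ≈⟨ +-congˡ (sum-zero (λ k → f≈0 (punchIn i k) (punchInᵢ≢i i k))) ⟩
    f i + 0#                            ≈⟨ +-identityʳ (f i) ⟩
    f i                                 ∎

  δ-refl : (i : Fin n) → δ R i i ≡ 1#
  δ-refl i = if-⌊⌋-yes (i ≟ i) ≡.refl

  δ-≢ : {i j : Fin n} → i ≢ j → δ R i j ≡ 0#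
  δ-≢ {i = i} {j} i≢j = if-⌊⌋-no (i ≟ j) i≢j

  sum-δ : (i : Fin n) → sum (δ R i) ≈ 1#
  sum-δ i = trans (sum-single i (δ R i) (λ j j≢i → reflexive (δ-≢ (j≢i ∘ ≡.sym)))) (reflexive (δ-refl i))

  sum-δ-* : (i : Fin n) (f : Fin n → Carrier) → sum (λ j → δ R i j * f j) ≈ f i
  sum-δ-* i f = begin
    sum (λ j → δ R i j * f j)
      ≈⟨ sum-single i _ (λ j j≢i → trans (*-congʳ (reflexive (δ-≢ (j≢i ∘ ≡.sym)))) (zeroˡ (f j))) ⟩
    δ R i i * f i             ≈⟨ *-congʳ (reflexive (δ-refl i)) ⟩
    1# * f i                  ≈⟨ *-identityˡ (f i) ⟩
    f i                       ∎

  module _ {V : ℕ} where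
    open Edge

    edgeEnergy : (Fin V → Carrier) → (Fin V → Carrier) → Edge R V → Carrier
    edgeEnergy a b e = cond e * ((a (src e) - a (tgt e)) * (b (src e) - b (tgt e)))

    energy : List (Edge R V) → (Fin V → Carrier) → (Fin V → Carrier) → Carrier
    energy []       a b = 0#
    energy (e ∷ es) a b = edgeEnergy a b e + energy es a b

    current : List (Edge R V) → (Fin V → Carrier) → Fin V → Carrier
    current es φ v = foldr (λ e acc → edgeCurrent R φ e v + acc) 0# es

    sum-*-if-≟ : (a : Fin V → Carrier) (s : Fin V) (x : Carrier) →
                 sum (λ v → a v * (if ⌊ v ≟ s ⌋ then x else 0#)) ≈ a s * x
    sum-*-if-≟ a s x = trans
      (sum-single s _ (λ v v≢s → trans (*-congˡ (reflexive (if-⌊⌋-no (v ≟ s) v≢s))) (zeroʳ (a v))))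
      (*-congˡ (reflexive (if-⌊⌋-yes (s ≟ s) ≡.refl)))

    sum-*-edgeCurrent : (a b : Fin V → Carrier) (e : Edge R V) →
                        sum (λ v → a v * edgeCurrent R b e v) ≈ edgeEnergy a b e
    sum-*-edgeCurrent a b e = begin
      sum (λ v → a v * edgeCurrent R b e v)
        ≈⟨ sum-*-distribˡ-+ a _ _ ⟩
      sum (λ v → a v * (if ⌊ v ≟ s ⌋ then k * (bs - bt) else 0#))
        + sum (λ v → a v * (if ⌊ v ≟ t ⌋ then k * (bt - bs) else 0#))
        ≈⟨ +-cong (sum-*-if-≟ a s _) (sum-*-if-≟ a t _) ⟩
      a s * (k * (bs - bt)) + a t * (k * (bt - bs))
        ≈⟨ +-congˡ (*-congˡ (*-congˡ (sym (⁻¹-anti-homo‿- bs bt)))) ⟩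
      a s * (k * (bs - bt)) + a t * (k * - (bs - bt))
        ≈⟨ +-congˡ (trans (*-congˡ (sym (-‿distribʳ-* k _))) (sym (-‿distribʳ-* (a t) _))) ⟩
      a s * (k * (bs - bt)) - a t * (k * (bs - bt))
        ≈⟨ [y-z]x≈yx-zx _ (a s) (a t) ⟨
      (a s - a t) * (k * (bs - bt))
        ≈⟨ trans (sym (*-assoc _ k _)) (trans (*-congʳ (*-comm _ k)) (*-assoc k _ _)) ⟩
      k * ((a s - a t) * (bs - bt))
        ∎
      where
      s = src e
      t = tgt e
      k = cond e
      bs = b s
      bt = b t

    sum-*-current : (es : List (Edge R V)) (a b : Fin V → Carrier) →
                    sum (λ v → a v * current es b v) ≈ energy es a b
    sum-*-current []       a b = sum-zero (λ v → zeroʳ (a v))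
    sum-*-current (e ∷ es) a b = begin
      sum (λ v → a v * (edgeCurrent R b e v + current es b v))
        ≈⟨ sum-*-distribˡ-+ a _ _ ⟩
      sum (λ v → a v * edgeCurrent R b e v) + sum (λ v → a v * current es b v)
        ≈⟨ +-cong (sum-*-edgeCurrent a b e) (sum-*-current es a b) ⟩
      edgeEnergy a b e + energy es a b
        ∎

    energy-sym : (es : List (Edge R V)) (a b : Fin V → Carrier) → energy es a b ≈ energy es b a
    energy-sym []       a b = refl
    energy-sym (e ∷ es) a b = +-cong (*-congˡ (*-comm _ _)) (energy-sym es a b)

    energy-const : (es : List (Edge R V)) (x : Carrier) (b : Fin V → Carrier) →
                   energy es (λ _ → x) b ≈ 0#
    energy-const []       x b = refl
    energy-const (e ∷ es) x b = begin
      cond e * ((x - x) * _) + energy es (λ _ → x) b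
        ≈⟨ +-cong (*-congˡ (*-congʳ (-‿inverseʳ x))) (energy-const es x b) ⟩
      cond e * (0# * _) + 0#                         ≈⟨ +-identityʳ _ ⟩
      cond e * (0# * _)                              ≈⟨ trans (*-congˡ (zeroˡ _)) (zeroʳ (cond e)) ⟩
      0#                                             ∎

  sum-*-netCurrent-harmonic : (N : Network R n) (a φ : Fin (n ℕ.+ interior N) → Carrier) →
    (∀ k → netCurrent R N φ (intr R N k) ≈ 0#) →
    sum (λ v → a v * netCurrent R N φ v) ≈ sum (λ i → a (bdry R N i) * netCurrent R N φ (bdry R N i))
  sum-*-netCurrent-harmonic {n} N a φ harmonic = begin
    sum (λ v → a v * netCurrent R N φ v)
      ≈⟨ sum-↑ n (interior N) _ ⟩
    sum (λ i → a (bdry R N i) * netCurrent R N φ (bdry R N i))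
      + sum (λ k → a (intr R N k) * netCurrent R N φ (intr R N k))
      ≈⟨ +-congˡ (sum-zero (λ k → trans (*-congˡ (harmonic k)) (zeroʳ _))) ⟩
    sum (λ i → a (bdry R N i) * netCurrent R N φ (bdry R N i)) + 0#
      ≈⟨ +-identityʳ _ ⟩
    sum (λ i → a (bdry R N i) * netCurrent R N φ (bdry R N i))
      ∎

  module ResponseMatrix {N : Network R n} {M : Matrix R n n} (H : IsResponseMatrix R N M) where

    harmonicExtension : Fin n → Fin (n ℕ.+ interior N) → Carrier
    harmonicExtension j = proj₁ (H (δ R j))

    private
      ψ = harmonicExtension

      ψ-boundary : ∀ j i → ψ j (bdry R N i) ≈ δ R j i
      ψ-boundary j = proj₁ (proj₂ (H (δ R j)))

      ψ-harmonic : ∀ j k → netCurrent R N (ψ j) (intr R N k) ≈ 0#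
      ψ-harmonic j = proj₁ (proj₂ (proj₂ (H (δ R j))))

      ψ-current : ∀ j i → netCurrent R N (ψ j) (bdry R N i) ≈ M i j
      ψ-current j i = begin
        netCurrent R N (ψ j) (bdry R N i) ≈⟨ proj₂ (proj₂ (proj₂ (H (δ R j)))) i ⟨
        Σᶠ R (λ k → M i k * δ R j k)       ≡⟨ Σᶠ≡sum (λ k → M i k * δ R j k) ⟩
        sum (λ k → M i k * δ R j k)        ≈⟨ sum-cong-≋ (λ k → *-comm (M i k) (δ R j k)) ⟩
        sum (λ k → δ R j k * M i k)        ≈⟨ sum-δ-* j (M i) ⟩
        M i j                               ∎

    energy-harmonicExtension : ∀ i j → energy (edges N) (ψ i) (ψ j) ≈ M i j
    energy-harmonicExtension i j = begin
      energy (edges N) (ψ i) (ψ j)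
        ≈⟨ sum-*-current (edges N) (ψ i) (ψ j) ⟨
      sum (λ v → ψ i v * netCurrent R N (ψ j) v)
        ≈⟨ sum-*-netCurrent-harmonic N (ψ i) (ψ j) (ψ-harmonic j) ⟩
      sum (λ l → ψ i (bdry R N l) * netCurrent R N (ψ j) (bdry R N l))
        ≈⟨ sum-cong-≋ (λ l → *-cong (ψ-boundary i l) (ψ-current j l)) ⟩
      sum (λ l → δ R i l * M l j)
        ≈⟨ sum-δ-* i (λ l → M l j) ⟩
      M i j
        ∎

    symmetric : ∀ i j → M i j ≈ M j i
    symmetric i j = begin
      M i j                        ≈⟨ energy-harmonicExtension i j ⟨
      energy (edges N) (ψ i) (ψ j) ≈⟨ energy-sym (edges N) (ψ i) (ψ j) ⟩
      energy (edges N) (ψ j) (ψ i) ≈⟨ energy-harmonicExtension j i ⟩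
      M j i                        ∎

    columnSum≈0 : ∀ j → sum (λ i → M i j) ≈ 0#
    columnSum≈0 j = begin
      sum (λ i → M i j)
        ≈⟨ sum-cong-≋ (λ i → trans (sym (ψ-current j i)) (sym (*-identityˡ _))) ⟩
      sum (λ i → 1# * netCurrent R N (ψ j) (bdry R N i))
        ≈⟨ sum-*-netCurrent-harmonic N (λ _ → 1#) (ψ j) (ψ-harmonic j) ⟨
      sum (λ v → 1# * netCurrent R N (ψ j) v)
        ≈⟨ sum-*-current (edges N) (λ _ → 1#) (ψ j) ⟩
      energy (edges N) (λ _ → 1#) (ψ j)
        ≈⟨ energy-const (edges N) 1# (ψ j) ⟩
      0#
        ∎

    rowSum≈0 : ∀ i → sum (M i) ≈ 0#
    rowSum≈0 i = trans (sum-cong-≋ (symmetric i)) (columnSum≈0 i)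

  gMat-≤ : {i l : Fin n} → l ≤ i → gMat R i l ≡ 1#
  gMat-≤ {i = i} {l} l≤i = if-⌊⌋-yes (toℕ l ℕ.≤? toℕ i) l≤i

  gMat-> : {i l : Fin n} → i < l → gMat R i l ≡ 0#
  gMat-> {i = i} {l} i<l = if-⌊⌋-no (toℕ l ℕ.≤? toℕ i) (ℕ.<⇒≱ i<l)

  gMat-zero : (l : Fin (ℕ.suc n)) → gMat R zero l ≡ δ R zero l
  gMat-zero {n} zero    = gMat-≤ {ℕ.suc n} {zero} {zero} ℕ.z≤n
  gMat-zero {n} (suc l) = gMat-> {ℕ.suc n} {zero} {suc l} (ℕ.s≤s ℕ.z≤n)

  gMat-fromℕ : (l : Fin (ℕ.suc n)) → gMat R (fromℕ n) l ≡ 1#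
  gMat-fromℕ l = gMat-≤ (≤fromℕ l)

  gMat-suc-inject₁ : (i : Fin n) (l : Fin (ℕ.suc n)) →
                     gMat R (suc i) l - gMat R (inject₁ i) l ≈ δ R (suc i) l
  gMat-suc-inject₁ i l with <-cmp l (suc i)
  ... | tri< l<1+i l≢1+i _ = begin
    gMat R (suc i) l - gMat R (inject₁ i) l ≡⟨ ≡.cong₂ _-_ (gMat-≤ (ℕ.<⇒≤ l<1+i)) (gMat-≤ l≤i) ⟩
    1# - 1#                                 ≈⟨ -‿inverseʳ 1# ⟩
    0#                                      ≡⟨ δ-≢ (l≢1+i ∘ ≡.sym) ⟨
    δ R (suc i) l                           ∎
    where l≤i = ≡.subst (toℕ l ℕ.≤_) (≡.sym (toℕ-inject₁ i)) (ℕ.s≤s⁻¹ l<1+i)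
  ... | tri≈ _ ≡.refl _ = begin
    gMat R (suc i) (suc i) - gMat R (inject₁ i) (suc i)
      ≡⟨ ≡.cong₂ _-_ (gMat-≤ (≤-refl {x = suc i})) (gMat-> (≤̄⇒inject₁< (≤-refl {x = i}))) ⟩
    1# - 0#              ≈⟨ x-0#≈x 1# ⟩
    1#                   ≡⟨ δ-refl (suc i) ⟨
    δ R (suc i) (suc i)  ∎
  ... | tri> _ l≢1+i 1+i<l = begin
    gMat R (suc i) l - gMat R (inject₁ i) l ≡⟨ ≡.cong₂ _-_ (gMat-> 1+i<l) (gMat-> (ℕ<⇒inject₁< (ℕ.<⇒≤ 1+i<l))) ⟩
    0# - 0#                                 ≈⟨ -‿inverseʳ 0# ⟩
    0#                                      ≡⟨ δ-≢ (l≢1+i ∘ ≡.sym) ⟨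
    δ R (suc i) l                           ∎

  sum-aVec : (i : Fin n) → sum (aVec R i) ≈ 0#
  sum-aVec i = begin
    sum (aVec R i)                          ≈⟨ sum-minus (δ R i) (δ R (prev R i)) ⟩
    sum (δ R i) - sum (δ R (prev R i))      ≈⟨ +-cong (sum-δ i) (-‿cong (sum-δ (prev R i))) ⟩
    1# - 1#                                 ≈⟨ -‿inverseʳ 1# ⟩
    0#                                      ∎

  sum-aVec-*-gMat : (i l : Fin n) →
                    sum (λ k → aVec R i k * gMat R k l) ≈ gMat R i l - gMat R (prev R i) l
  sum-aVec-*-gMat i l = begin
    sum (λ k → aVec R i k * gMat R k l)
      ≈⟨ sum-cong-≋ (λ k → [y-z]x≈yx-zx (gMat R k l) (δ R i k) (δ R (prev R i) k)) ⟩
    sum (λ k → δ R i k * gMat R k l - δ R (prev R i) k * gMat R k l)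
      ≈⟨ sum-minus (λ k → δ R i k * gMat R k l) (λ k → δ R (prev R i) k * gMat R k l) ⟩
    sum (λ k → δ R i k * gMat R k l) - sum (λ k → δ R (prev R i) k * gMat R k l)
      ≈⟨ +-cong (sum-δ-* i (λ k → gMat R k l)) (-‿cong (sum-δ-* (prev R i) (λ k → gMat R k l))) ⟩
    gMat R i l - gMat R (prev R i) l
      ∎

  sum-gMat-prev-* : (i : Fin n) (b : Fin n → Carrier) → sum b ≈ 0# →
                    sum (λ l → (gMat R i l - gMat R (prev R i) l) * b l) ≈ b i
  sum-gMat-prev-* {ℕ.suc n} zero b Σb≈0 = begin
    sum (λ l → (gMat R zero l - gMat R (fromℕ n) l) * b l)
      ≈⟨ sum-cong-≋ (λ l → *-congʳ {b l} (reflexive (≡.cong₂ _-_ (gMat-zero l) (gMat-fromℕ {n} l)))) ⟩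
    sum (λ l → (δ R zero l - 1#) * b l)
      ≈⟨ sum-cong-≋ (λ l → [y-z]x≈yx-zx (b l) (δ R zero l) 1#) ⟩
    sum (λ l → δ R zero l * b l - 1# * b l)
      ≈⟨ sum-minus (λ l → δ R zero l * b l) (λ l → 1# * b l) ⟩
    sum (λ l → δ R zero l * b l) - sum (λ l → 1# * b l)
      ≈⟨ +-cong (sum-δ-* zero b) (-‿cong (trans (sum-cong-≋ (λ l → *-identityˡ (b l))) Σb≈0)) ⟩
    b zero - 0#
      ≈⟨ x-0#≈x (b zero) ⟩
    b zero
      ∎
  sum-gMat-prev-* {ℕ.suc n} (suc i) b _ =
    trans (sum-cong-≋ (λ l → *-congʳ {b l} (gMat-suc-inject₁ i l))) (sum-δ-* (suc i) b)

  gForm : (Fin n → Carrier) → (Fin n → Carrier) → Carrier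
  gForm a b = sum λ k → sum λ l → a k * gMat R k l * b l

  gForm-cong : {a a′ b b′ : Fin n → Carrier} →
               (∀ k → a k ≈ a′ k) → (∀ l → b l ≈ b′ l) → gForm a b ≈ gForm a′ b′
  gForm-cong a≈a′ b≈b′ = sum-cong-≋ (λ k → sum-cong-≋ (λ l → *-cong (*-congʳ (a≈a′ k)) (b≈b′ l)))

  gForm-aVec : (i : Fin n) (b : Fin n → Carrier) → sum b ≈ 0# → gForm (aVec R i) b ≈ b i
  gForm-aVec i b Σb≈0 = begin
    sum (λ k → sum λ l → aVec R i k * gMat R k l * b l)
      ≈⟨ ∑-comm (λ k l → aVec R i k * gMat R k l * b l) ⟩
    sum (λ l → sum λ k → aVec R i k * gMat R k l * b l)
      ≈⟨ sum-cong-≋ (λ l → *-distribʳ-sum (b l) (λ k → aVec R i k * gMat R k l)) ⟨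
    sum (λ l → sum (λ k → aVec R i k * gMat R k l) * b l)
      ≈⟨ sum-cong-≋ (λ l → *-congʳ {b l} (sum-aVec-*-gMat i l)) ⟩
    sum (λ l → (gMat R i l - gMat R (prev R i) l) * b l)
      ≈⟨ sum-gMat-prev-* i b Σb≈0 ⟩
    b i
      ∎

  Ωaux-↑ˡ : (M : Matrix R n n) (i k : Fin n) → Ωaux R M i (k ↑ˡ n) ≡ aVec R i k
  Ωaux-↑ˡ {n} M i k rewrite splitAt-↑ˡ n k n = ≡.refl

  Ωaux-↑ʳ : (M : Matrix R n n) (i j : Fin n) → Ωaux R M i (n ↑ʳ j) ≡ M i j
  Ωaux-↑ʳ {n} M i j rewrite splitAt-↑ʳ n n j = ≡.refl

  λ2n-↑ˡ-↑ˡ : (k l : Fin n) → λ2n R {n} (k ↑ˡ n) (l ↑ˡ n) ≡ 0#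
  λ2n-↑ˡ-↑ˡ {n} k l rewrite splitAt-↑ˡ n k n | splitAt-↑ˡ n l n = ≡.refl

  λ2n-↑ˡ-↑ʳ : (k l : Fin n) → λ2n R {n} (k ↑ˡ n) (n ↑ʳ l) ≡ gMat R k l
  λ2n-↑ˡ-↑ʳ {n} k l rewrite splitAt-↑ˡ n k n | splitAt-↑ʳ n n l = ≡.refl

  λ2n-↑ʳ-↑ˡ : (k l : Fin n) → λ2n R {n} (n ↑ʳ k) (l ↑ˡ n) ≡ - gMat R l k
  λ2n-↑ʳ-↑ˡ {n} k l rewrite splitAt-↑ʳ n n k | splitAt-↑ˡ n l n = ≡.refl

  λ2n-↑ʳ-↑ʳ : (k l : Fin n) → λ2n R {n} (n ↑ʳ k) (n ↑ʳ l) ≡ 0#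
  λ2n-↑ʳ-↑ʳ {n} k l rewrite splitAt-↑ʳ n n k | splitAt-↑ʳ n n l = ≡.refl

  λform-blocks : (u v : Fin (n ℕ.+ n) → Carrier) →
                 λform R {n} u v ≈ gForm (u ∘ (_↑ˡ n)) (v ∘ (n ↑ʳ_)) - gForm (v ∘ (_↑ˡ n)) (u ∘ (n ↑ʳ_))
  λform-blocks {n} u v = begin
    λform R {n} u v
      ≡⟨ ≡.trans (Σᶠ≡sum (λ p → Σᶠ R (T p))) (sum-cong-≗ (λ p → Σᶠ≡sum (T p))) ⟩
    sum (λ p → sum (T p))
      ≈⟨ sum-↑ n n _ ⟩
    sum (λ k → sum (T (k ↑ˡ n))) + sum (λ k → sum (T (n ↑ʳ k)))
      ≈⟨ +-cong (sum-cong-≋ upper) (sum-cong-≋ lower) ⟩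
    gForm uˡ vʳ + sum (λ k → - sum (λ l → vˡ l * gMat R l k * uʳ k))
      ≈⟨ +-congˡ (trans (sum-neg (λ k → sum (λ l → vˡ l * gMat R l k * uʳ k)))
                        (-‿cong (∑-comm (λ k l → vˡ l * gMat R l k * uʳ k)))) ⟩
    gForm uˡ vʳ - gForm vˡ uʳ
      ∎
    where
    uˡ uʳ vˡ vʳ : Fin n → Carrier
    uˡ = u ∘ (_↑ˡ n)
    uʳ = u ∘ (n ↑ʳ_)
    vˡ = v ∘ (_↑ˡ n)
    vʳ = v ∘ (n ↑ʳ_)

    T : Fin (n ℕ.+ n) → Fin (n ℕ.+ n) → Carrier
    T p q = u p * λ2n R {n} p q * v q

    vanishing : ∀ p q → λ2n R {n} p q ≡ 0# → T p q ≈ 0#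
    vanishing p q λ≡0 = trans (*-congʳ (trans (*-congˡ (reflexive λ≡0)) (zeroʳ _))) (zeroˡ _)

    upper : ∀ k → sum (T (k ↑ˡ n)) ≈ sum (λ l → uˡ k * gMat R k l * vʳ l)
    upper k = begin
      sum (T (k ↑ˡ n))
        ≈⟨ sum-↑ n n _ ⟩
      sum (λ l → T (k ↑ˡ n) (l ↑ˡ n)) + sum (λ l → T (k ↑ˡ n) (n ↑ʳ l))
        ≈⟨ +-cong (sum-zero (λ l → vanishing (k ↑ˡ n) (l ↑ˡ n) (λ2n-↑ˡ-↑ˡ k l)))
                  (sum-cong-≋ (λ l → *-congʳ (*-congˡ (reflexive (λ2n-↑ˡ-↑ʳ k l))))) ⟩
      0# + sum (λ l → uˡ k * gMat R k l * vʳ l)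
        ≈⟨ +-identityˡ _ ⟩
      sum (λ l → uˡ k * gMat R k l * vʳ l)
        ∎

    transposed : ∀ k l → T (n ↑ʳ k) (l ↑ˡ n) ≈ - (vˡ l * gMat R l k * uʳ k)
    transposed k l = begin
      uʳ k * λ2n R {n} (n ↑ʳ k) (l ↑ˡ n) * vˡ l
        ≈⟨ *-congʳ (*-congˡ (reflexive (λ2n-↑ʳ-↑ˡ k l))) ⟩
      uʳ k * - gMat R l k * vˡ l
        ≈⟨ *-congʳ (-‿distribʳ-* (uʳ k) (gMat R l k)) ⟨
      - (uʳ k * gMat R l k) * vˡ l
        ≈⟨ -‿distribˡ-* (uʳ k * gMat R l k) (vˡ l) ⟨
      - (uʳ k * gMat R l k * vˡ l)
        ≈⟨ -‿cong (trans (*-comm _ (vˡ l)) (trans (*-congˡ (*-comm (uʳ k) _)) (sym (*-assoc _ _ _)))) ⟩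
      - (vˡ l * gMat R l k * uʳ k)
        ∎

    lower : ∀ k → sum (T (n ↑ʳ k)) ≈ - sum (λ l → vˡ l * gMat R l k * uʳ k)
    lower k = begin
      sum (T (n ↑ʳ k))
        ≈⟨ sum-↑ n n _ ⟩
      sum (λ l → T (n ↑ʳ k) (l ↑ˡ n)) + sum (λ l → T (n ↑ʳ k) (n ↑ʳ l))
        ≈⟨ +-cong (sum-cong-≋ (transposed k)) (sum-zero (λ l → vanishing (n ↑ʳ k) (n ↑ʳ l) (λ2n-↑ʳ-↑ʳ k l))) ⟩
      sum (λ l → - (vˡ l * gMat R l k * uʳ k)) + 0#
        ≈⟨ +-identityʳ _ ⟩
      sum (λ l → - (vˡ l * gMat R l k * uʳ k))
        ≈⟨ sum-neg (λ l → vˡ l * gMat R l k * uʳ k) ⟩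
      - sum (λ l → vˡ l * gMat R l k * uʳ k)
        ∎

  Ωaux-inV′ : (M : Matrix R n n) → (∀ i → sum (M i) ≈ 0#) → ∀ i → InV' R {n} (Ωaux R M i)
  Ωaux-inV′ {n} M rowSum≈0 i =
      trans (reflexive (Σᶠ≡sum (λ k → Ωaux R M i (k ↑ˡ n))))
            (trans (sum-cong-≋ (reflexive ∘ Ωaux-↑ˡ M i)) (sum-aVec i))
    , trans (reflexive (Σᶠ≡sum (λ j → Ωaux R M i (n ↑ʳ j))))
            (trans (sum-cong-≋ (reflexive ∘ Ωaux-↑ʳ M i)) (rowSum≈0 i))

  Ωaux-isotropic : (M : Matrix R n n) → (∀ i j → M i j ≈ M j i) → (∀ i → sum (M i) ≈ 0#) →
                   ∀ i j → λform R {n} (Ωaux R M i) (Ωaux R M j) ≈ 0#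
  Ωaux-isotropic {n} M symmetric rowSum≈0 i j = begin
    λform R {n} (Ωaux R M i) (Ωaux R M j)
      ≈⟨ λform-blocks {n} (Ωaux R M i) (Ωaux R M j) ⟩
    gForm (Ωaux R M i ∘ (_↑ˡ n)) (Ωaux R M j ∘ (n ↑ʳ_)) - gForm (Ωaux R M j ∘ (_↑ˡ n)) (Ωaux R M i ∘ (n ↑ʳ_))
      ≈⟨ +-cong (gForm-cong (reflexive ∘ Ωaux-↑ˡ M i) (reflexive ∘ Ωaux-↑ʳ M j))
                (-‿cong (gForm-cong (reflexive ∘ Ωaux-↑ˡ M j) (reflexive ∘ Ωaux-↑ʳ M i))) ⟩
    gForm (aVec R i) (M j) - gForm (aVec R j) (M i)
      ≈⟨ +-cong (gForm-aVec i (M j) (rowSum≈0 j)) (-‿cong (gForm-aVec j (M i) (rowSum≈0 i))) ⟩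
    M j i - M i j
      ≈⟨ +-congˡ (-‿cong (symmetric i j)) ⟩
    M j i - M j i
      ≈⟨ -‿inverseʳ (M j i) ⟩
    0#
      ∎

mainTheorem5 : ∀ {c ℓ} (R : CommutativeRing c ℓ) (n : ℕ) (N : Network R n) (M : Matrix R n n) →
    IsResponseMatrix R N M →
    -- every row of Ω^aux lies in V' (hence so does its row space)
    ((i : Fin n) → InV' R {n} (Ωaux R M i))
    -- Ω^aux λ_{2n} (Ω^aux)ᵀ = 0, i.e. the row space is isotropic
    × ((i j : Fin n) → CommutativeRing._≈_ R (λform R {n} (Ωaux R M i) (Ωaux R M j)) (CommutativeRing.0# R))
mainTheorem5 R n N M H = Ωaux-inV′ R M rowSum≈0 , Ωaux-isotropic R M symmetric rowSum≈0
  where open ResponseMatrix R {N = N} {M} H
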